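{- Let $q$ be a prime power and $s,m\ge1$ be integers. For any linear subspace $\mathcal{N}$ of $\mathbb{F}_q^{sm}$ and any $\mathbf{e}=(e_1,\dots,e_s)\in\mathbb{N}^s$, we have $\delta_{m,\mathbf{e}}(\mathcal{N})\le sm-\dim(\mathcal{N})+\min_{1\le i\le s}e_i$.
   Context: $\mathbb{N}$ denotes the positive integers. For $\mathbf{a}=(a_1,\dots,a_m)\in\mathbb{F}_q^m$ and $e\in\mathbb{N}$, $v_e(\mathbf{a})=0$ if $\mathbf{a}=\mathbf{0}$ and $v_e(\mathbf{a})=\min\{m,e\lceil\max\{j:a_j\neq0\}/e\rceil\}$ otherwise. For $\mathbf{A}=(\mathbf{a}^{(1)},\dots,\mathbf{a}^{(s)})\in\mathbb{F}_q^{sm}$ with $\mathbf{a}^{(i)}\in\mathbb{F}_q^m$, $V_{m,\mathbf{e}}(\mathbf{A})=\sum_{i=1}^sv_{e_i}(\mathbf{a}^{(i)})$. For a linear subspace $\mathcal{N}\subseteq\mathbb{F}_q^{sm}$, $\delta_{m,\mathbf{e}}(\mathcal{N})=\min_{\mathbf{A}\in\mathcal{N}\setminus\{\mathbf{0}\}}V_{m,\mathbf{e}}(\mathbf{A})$ if $\mathcal{N}\neq\{\mathbf{0}\}$, and $\delta_{m,\mathbf{e}}(\mathcal{N})=sm+1$ otherwise. -}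

module Defs where

open import Level using (Level; _⊔_)
open import Data.Nat using (ℕ; zero; suc; _∸_; _^_; _≤_; _⊓_; _/_)
  renaming (_+_ to _+ℕ_; _*_ to _*ℕ_)
open import Data.Nat.Primality using (Prime)
open import Data.Fin using (Fin; toℕ)
open import Data.List using (List; []; _∷_; length; map; concatMap; foldr)
open import Data.List.Relation.Unary.Any using (Any)
open import Data.List.Relation.Unary.AllPairs using (AllPairs)
open import Data.Product using (Σ; _×_; ∃)
open import Data.Bool using (Bool; true; false; if_then_else_)
open import Relation.Nullary using (¬_; Dec; yes; no)
open import Relation.Binary using (Decidable)
open import Algebra.Bundles using (CommutativeRing)
open import Relation.Binary.PropositionalEquality using (_≡_)
open import Relation.Nullary using (does)

IsPrimePower : ℕ → Set
IsPrimePower q = Σ ℕ λ p → Σ ℕ λ k → Prime p × (1 ≤ k) × (q ≡ p ^ k)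

record IsField {c ℓ} (R : CommutativeRing c ℓ) : Set (c ⊔ ℓ) where
  open CommutativeRing R
  field
    1≉0     : ¬ (1# ≈ 0#)
    inverse : ∀ x → ¬ (x ≈ 0#) → Σ Carrier λ y → (x * y) ≈ 1#

record FiniteField c ℓ (q : ℕ) : Set (Level.suc (c ⊔ ℓ)) where
  field
    commRing    : CommutativeRing c ℓ
    isField     : IsField commRing
  open CommutativeRing commRing public
  field
    _≟_         : Decidable _≈_
    elements    : List Carrier
    complete    : ∀ x → Any (x ≈_) elements
    distinct    : AllPairs (λ x y → ¬ (x ≈ y)) elements
    cardinality : length elements ≡ q
    primePower  : IsPrimePower q

∑ : (n : ℕ) → (Fin n → ℕ) → ℕ
∑ zero    f = 0
∑ (suc n) f = f Fin.zero +ℕ ∑ n (λ i → f (Fin.suc i))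
  where import Data.Fin as Fin

-- Minimum over Fin n (for n = 0 this is junk 0; only used for n ≥ 1).
minᶠ : (n : ℕ) → (Fin n → ℕ) → ℕ
minᶠ zero          f = 0
minᶠ (suc zero)    f = f Data.Fin.zero
minᶠ (suc (suc n)) f = f Data.Fin.zero ⊓ minᶠ (suc n) (λ i → f (Data.Fin.suc i))

-- e * ⌈ x / e ⌉ (junk value 0 when e = 0; only used for e ≥ 1).
roundUp : (e x : ℕ) → ℕ
roundUp zero    x = 0
roundUp (suc k) x = suc k *ℕ ((x +ℕ k) / suc k)

module _ {c ℓ q} (F : FiniteField c ℓ q) where
  open FiniteField F

  Vector : ℕ → Set c
  Vector n = Fin n → Carrier

  allFuns : ∀ {a} {A : Set a} → List A → (n : ℕ) → List (Fin n → A)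
  allFuns xs zero    = (λ ()) ∷ []
  allFuns xs (suc n) = concatMap (λ x → map (λ f → cons x f) (allFuns xs n)) xs
    where
      cons : ∀ {a} {A : Set a} {n} → A → (Fin n → A) → Fin (suc n) → A
      cons x f Data.Fin.zero    = x
      cons x f (Data.Fin.suc i) = f i

  -- max { j : a_j ≠ 0 } with 1-based indices, or 0 if a = 0.
  lastNonzero : (m : ℕ) → Vector m → ℕ
  lastNonzero zero    a = 0
  lastNonzero (suc m) a with lastNonzero m (λ i → a (Data.Fin.suc i))
  ... | suc j = suc (suc j)
  ... | zero  with a Data.Fin.zero ≟ 0#
  ...   | yes _ = 0
  ...   | no  _ = 1

  v : (m e : ℕ) → Vector m → ℕ
  v m e a with lastNonzero m a
  ... | zero  = 0
  ... | suc j = m ⊓ roundUp e (suc j)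

  Block : (s m : ℕ) → Set c
  Block s m = Fin s → Vector m

  V : (s m : ℕ) → (Fin s → ℕ) → Block s m → ℕ
  V s m e A = ∑ s (λ i → v m (e i) (A i))

  _≈ᴮ_ : ∀ {s m} → Block s m → Block s m → Set ℓ
  A ≈ᴮ B = ∀ i j → A i j ≈ B i j

  0ᴮ : ∀ {s m} → Block s m
  0ᴮ i j = 0#

  _+ᴮ_ : ∀ {s m} → Block s m → Block s m → Block s m
  (A +ᴮ B) i j = A i j + B i j

  _·ᴮ_ : ∀ {s m} → Carrier → Block s m → Block s m
  (x ·ᴮ A) i j = x * A i j

  lincomb : ∀ {s m} (d : ℕ) → (Fin d → Carrier) → (Fin d → Block s m) → Block s m
  lincomb zero    c b = 0ᴮ
  lincomb (suc d) c b = (c Data.Fin.zero ·ᴮ b Data.Fin.zero)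
                          +ᴮ lincomb d (λ k → c (Data.Fin.suc k)) (λ k → b (Data.Fin.suc k))

  record Subspace (s m : ℕ) : Set (Level.suc (c ⊔ ℓ)) where
    field
      Mem     : Block s m → Set (c ⊔ ℓ)
      Mem?    : ∀ A → Dec (Mem A)
      respect : ∀ {A B} → A ≈ᴮ B → Mem A → Mem B
      zero∈   : Mem 0ᴮ
      +∈      : ∀ {A B} → Mem A → Mem B → Mem (A +ᴮ B)
      ·∈      : ∀ x {A} → Mem A → Mem (x ·ᴮ A)

  record Basis {s m : ℕ} (N : Subspace s m) (d : ℕ) : Set (c ⊔ ℓ) where
    open Subspace N
    field
      vec         : Fin d → Block s m
      vec∈        : ∀ k → Mem (vec k)
      independent : ∀ (cf : Fin d → Carrier) → lincomb d cf vec ≈ᴮ 0ᴮ → ∀ k → cf k ≈ 0#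
      spanning    : ∀ A → Mem A → Σ (Fin d → Carrier) λ cf → A ≈ᴮ lincomb d cf vec

  HasDim : ∀ {s m} → Subspace s m → ℕ → Set (c ⊔ ℓ)
  HasDim N d = Basis N d

  isZeroᴮ : ∀ {s m} → Block s m → Bool
  isZeroᴮ {zero}  {m} A = true
  isZeroᴮ {suc s} {m} A with lastNonzero m (A Data.Fin.zero)
  ... | suc _ = false
  ... | zero  = isZeroᴮ {s} {m} (λ i → A (Data.Fin.suc i))

  -- δ_{m,e}(N) = min { V_{m,e}(A) : A ∈ N, A ≠ 0 }, or sm+1 if N = {0};
  -- computed by running over all q^{sm} elements of F_q^{sm}.
  δ : (s m : ℕ) → (Fin s → ℕ) → Subspace s m → ℕ
  δ s m e N = foldr step (s *ℕ m +ℕ 1) (allFuns (allFuns elements m) s)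
    where
      open Subspace N
      step : Block s m → ℕ → ℕ
      step A acc = if does (Mem? A) then (if isZeroᴮ A then acc else (V s m e A ⊓ acc)) else acc

module Submission where

-- Pick i₀ with e_{i₀} = min e and put X = sm − d.  Choose heights
-- h_1, …, h_s ≤ m with Σ h_i = X + 1 such that every block other than i₀ is
-- either empty (h_i = 0) or full (h_i = m); this is a "profile".  Requiring
-- the i-th block of A to vanish at the coordinates j > h_i imposes
-- sm − (X + 1) < d homogeneous linear conditions, so some nonzero A ∈ N
-- satisfies them.  For such an A, v_{e_i}(a^(i)) ≤ h_i on the empty or full
-- blocks, while rounding up to a multiple of e_{i₀} costs at most e_{i₀} − 1
-- on block i₀; hence V(A) ≤ X + 1 + e_{i₀} − 1 = sm − d + min e.  If d = 0,
-- δ(N) = sm + 1 and the bound holds because min e ≥ 1.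

open import Defs
open import Level using (Level; _⊔_)
open import Data.Nat using (ℕ; _+_; _*_; _∸_; _≤_)
open import Data.Fin using (Fin)

open import Data.Nat using (zero; suc; _<_; z≤n; s≤s; _⊓_; _/_; _%_; NonZero)
open import Data.Nat.Properties
  using ( ≤-refl; ≤-trans; ≤-pred; ≤-reflexive; ≤-antisym; +-assoc; +-suc; *-zeroʳ; *-comm
        ; +-mono-≤; +-monoˡ-≤; +-monoʳ-≤; +-cancelʳ-<; ⊓-sel; m⊓n≤m; m⊓n≤n
        ; m∸n+n≡m; m+[n∸m]≡n; m≤n+m∸n; m∸n≤m; +-commutativeSemigroup; module ≤-Reasoning)
open import Data.Nat.DivMod using (m≡m%n+[m/n]*n; m%n<n; m<n*o⇒m/o<n; m/n*n≤m)
open import Data.Fin using (toℕ) renaming (zero to fzero; suc to fsuc; _≟_ to _≟ᶠ_)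
open import Data.Fin.Properties using (toℕ<n) renaming (suc-injective to fsuc-injective)
open import Data.Vec.Functional using (tail) renaming (_∷_ to _∷ᶠ_)
open import Data.List using (List; []; _∷_; _++_; length; map; foldr)
open import Data.List.Properties using (length-map; length-++)
open import Data.List.Membership.Propositional using (_∈_)
open import Data.List.Membership.Propositional.Properties using (∈-map⁺; ∈-++⁺ˡ; ∈-++⁺ʳ)
open import Data.List.Relation.Unary.Any as Any using (Any; here; there)
open import Data.List.Relation.Unary.Any.Properties using (map⁺; concatMap⁺)
open import Data.Product using (Σ; _×_; _,_; proj₁; proj₂)
open import Data.Sum using (_⊎_; inj₁; inj₂)
open import Data.Empty using (⊥-elim)
open import Data.Bool using (true; false; if_then_else_)
open import Relation.Nullary using (¬_; yes; no; does)
open import Relation.Binary using (Decidable)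
open import Relation.Binary.PropositionalEquality
  using (_≡_; _≢_; refl; sym; trans; cong; cong₂; subst; module ≡-Reasoning)
open import Algebra.Bundles using (CommutativeRing)
open import Algebra.Properties.CommutativeSemigroup +-commutativeSemigroup
  using (interchange; x∙yz≈y∙xz; xy∙z≈x∙zy)

∑-cong : ∀ s {f g : Fin s → ℕ} → (∀ i → f i ≡ g i) → ∑ s f ≡ ∑ s g
∑-cong zero    f≡g = refl
∑-cong (suc s) f≡g = cong₂ _+_ (f≡g fzero) (∑-cong s (λ i → f≡g (fsuc i)))

∑-mono : ∀ s {f g : Fin s → ℕ} → (∀ i → f i ≤ g i) → ∑ s f ≤ ∑ s g
∑-mono zero    f≤g = z≤n
∑-mono (suc s) f≤g = +-mono-≤ (f≤g fzero) (∑-mono s (λ i → f≤g (fsuc i)))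

∑-distrib-+ : ∀ s (f g : Fin s → ℕ) → ∑ s (λ i → f i + g i) ≡ ∑ s f + ∑ s g
∑-distrib-+ zero    f g = refl
∑-distrib-+ (suc s) f g =
  trans (cong ((f fzero + g fzero) +_) (∑-distrib-+ s (tail f) (tail g)))
        (interchange (f fzero) (g fzero) (∑ s (tail f)) (∑ s (tail g)))

∑-const : ∀ s c → ∑ s (λ _ → c) ≡ s * c
∑-const zero    c = refl
∑-const (suc s) c = cong (c +_) (∑-const s c)

∑-complement : ∀ s m (h : Fin s → ℕ) → (∀ i → h i ≤ m) →
               ∑ s (λ i → m ∸ h i) + ∑ s h ≡ s * m
∑-complement s m h h≤m = begin
  ∑ s (λ i → m ∸ h i) + ∑ s h   ≡⟨ sym (∑-distrib-+ s (λ i → m ∸ h i) h) ⟩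
  ∑ s (λ i → m ∸ h i + h i)     ≡⟨ ∑-cong s (λ i → m∸n+n≡m (h≤m i)) ⟩
  ∑ s (λ _ → m)                 ≡⟨ ∑-const s m ⟩
  s * m                         ∎
  where open ≡-Reasoning

∑-≤-except : ∀ s (f g : Fin s → ℕ) (i₀ : Fin s) c →
             (∀ i → i ≢ i₀ → f i ≤ g i) → f i₀ ≤ g i₀ + c → ∑ s f ≤ ∑ s g + c
∑-≤-except (suc s) f g fzero c f≤g fi₀≤ = begin
  f fzero + ∑ s (tail f)     ≤⟨ +-mono-≤ fi₀≤ (∑-mono s (λ i → f≤g (fsuc i) (λ ()))) ⟩
  g fzero + c + ∑ s (tail g)   ≡⟨ xy∙z≈x∙zy (g fzero) c (∑ s (tail g)) ⟩
  g fzero + (∑ s (tail g) + c) ≡⟨ +-assoc (g fzero) (∑ s (tail g)) c ⟨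
  g fzero + ∑ s (tail g) + c   ∎
  where open ≤-Reasoning
∑-≤-except (suc s) f g (fsuc j) c f≤g fi₀≤ = begin
  f fzero + ∑ s (tail f)       ≤⟨ +-mono-≤ (f≤g fzero (λ ())) (∑-≤-except s _ _ j c tail-bound fi₀≤) ⟩
  g fzero + (∑ s (tail g) + c) ≡⟨ +-assoc (g fzero) (∑ s (tail g)) c ⟨
  g fzero + ∑ s (tail g) + c   ∎
  where
    open ≤-Reasoning
    tail-bound : ∀ i → i ≢ j → f (fsuc i) ≤ g (fsuc i)
    tail-bound i i≢j = f≤g (fsuc i) (λ eq → i≢j (fsuc-injective eq))

minᶠ-attained : ∀ s (e : Fin s → ℕ) → 1 ≤ s → Σ (Fin s) λ i → e i ≡ minᶠ s e
minᶠ-attained (suc zero)    e _ = fzero , refl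
minᶠ-attained (suc (suc s)) e _
  with minᶠ-attained (suc s) (tail e) (s≤s z≤n) | ⊓-sel (e fzero) (minᶠ (suc s) (tail e))
... | _     | inj₁ head-min = fzero , sym head-min
... | i , p | inj₂ tail-min = fsuc i , trans p (sym tail-min)

-- A total of (n ∸ d) + 1 leaves fewer than d of n coordinates uncovered.
n<d+suc[n∸d] : ∀ n d → n < d + suc (n ∸ d)
n<d+suc[n∸d] n d = subst (n <_) (sym (+-suc d (n ∸ d))) (s≤s (m≤n+m∸n n d))

-- For d ≥ 1 and sm ≥ 1, X = sm ∸ d is a legal profile size (X < sm).
∸-suc-< : ∀ n d → suc n ∸ suc d < suc n
∸-suc-< n d = s≤s (m∸n≤m n d)

suc-+-pred : ∀ x e → 1 ≤ e → suc x + (e ∸ 1) ≡ x + e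
suc-+-pred x e 1≤e = trans (sym (+-suc x (e ∸ 1))) (cong (x +_) (m+[n∸m]≡n 1≤e))

-- δ is computed as a right fold of a decreasing step function; these two
-- facts bound such a fold by its initial value and by any witnessed value.
foldr-≤-init : ∀ {a} {A : Set a} (f : A → ℕ → ℕ) → (∀ x n → f x n ≤ n) →
               ∀ z xs → foldr f z xs ≤ z
foldr-≤-init f decreasing z []       = ≤-refl
foldr-≤-init f decreasing z (x ∷ xs) = ≤-trans (decreasing x _) (foldr-≤-init f decreasing z xs)

foldr-≤-witness : ∀ {a} {A : Set a} (f : A → ℕ → ℕ) → (∀ x n → f x n ≤ n) →
                  ∀ z t xs → Any (λ x → ∀ n → f x n ≤ t) xs → foldr f z xs ≤ t
foldr-≤-witness f decreasing z t (x ∷ xs) (here  x≤t)  = x≤t _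
foldr-≤-witness f decreasing z t (x ∷ xs) (there xs≤t) =
  ≤-trans (decreasing x _) (foldr-≤-witness f decreasing z t xs xs≤t)

EmptyOrFull : ℕ → ℕ → Set
EmptyOrFull M h = h ≡ 0 ⊎ h ≡ M

fullBlocks : ∀ M s u → u ≤ s →
             Σ (Fin s → ℕ) λ h → (∀ i → EmptyOrFull M (h i)) × ∑ s h ≡ u * M
fullBlocks M s       zero    _         = (λ _ → 0) , (λ _ → inj₁ refl) , trans (∑-const s 0) (*-zeroʳ s)
fullBlocks M (suc s) (suc u) (s≤s u≤s) with fullBlocks M s u u≤s
... | h , h-shape , h-sum = M ∷ᶠ h , (λ { fzero → inj₂ refl ; (fsuc i) → h-shape i }) , cong (M +_) h-sum

blocksAround : ∀ M s (i₀ : Fin s) b u → u < s →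
               Σ (Fin s → ℕ) λ h → h i₀ ≡ b × (∀ i → i ≢ i₀ → EmptyOrFull M (h i)) × ∑ s h ≡ b + u * M
blocksAround M (suc s) fzero b u (s≤s u≤s) with fullBlocks M s u u≤s
... | h , h-shape , h-sum = b ∷ᶠ h , refl , shape , cong (b +_) h-sum
  where
    shape : ∀ i → i ≢ fzero → EmptyOrFull M ((b ∷ᶠ h) i)
    shape fzero    i≢0 = ⊥-elim (i≢0 refl)
    shape (fsuc i) _   = h-shape i
blocksAround M (suc s) (fsuc j) b zero _ with blocksAround M s j b zero (≤-trans (s≤s z≤n) (toℕ<n j))
... | h , h-i₀ , h-shape , h-sum = 0 ∷ᶠ h , h-i₀ , shape , h-sum
  where
    shape : ∀ i → i ≢ fsuc j → EmptyOrFull M ((0 ∷ᶠ h) i)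
    shape fzero    _   = inj₁ refl
    shape (fsuc i) i≢j = h-shape i (λ eq → i≢j (cong fsuc eq))
blocksAround M (suc s) (fsuc j) b (suc u) (s≤s u<s) with blocksAround M s j b u u<s
... | h , h-i₀ , h-shape , h-sum = M ∷ᶠ h , h-i₀ , shape , trans (cong (M +_) h-sum) (x∙yz≈y∙xz M b (u * M))
  where
    shape : ∀ i → i ≢ fsuc j → EmptyOrFull M ((M ∷ᶠ h) i)
    shape fzero    _   = inj₂ refl
    shape (fsuc i) i≢j = h-shape i (λ eq → i≢j (cong fsuc eq))

record Profile (M s : ℕ) (i₀ : Fin s) (k : ℕ) : Set where
  field
    height       : Fin s → ℕ
    height≤      : ∀ i → height i ≤ M
    height-sum   : ∑ s height ≡ k
    height-shape : ∀ i → i ≢ i₀ → EmptyOrFull M (height i)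

-- Every total k = X + 1 ≤ sM is realised: write X = uM + r with r < M and
-- put height r + 1 on block i₀ and u < s full blocks elsewhere.
profile : ∀ M .{{_ : NonZero M}} s (i₀ : Fin s) X → X < s * M → Profile M s i₀ (suc X)
profile M s i₀ X X<sM with blocksAround M s i₀ (suc (X % M)) (X / M) (m<n*o⇒m/o<n X<sM)
... | h , h-i₀ , h-shape , h-sum = record
  { height       = h
  ; height≤      = h≤M
  ; height-sum   = trans h-sum (cong suc (sym (m≡m%n+[m/n]*n X M)))
  ; height-shape = h-shape
  }
  where
    h≤M : ∀ i → h i ≤ M
    h≤M i with i ≟ᶠ i₀
    ... | yes refl = subst (_≤ M) (sym h-i₀) (m%n<n X M)
    ... | no i≢i₀  with h-shape i i≢i₀
    ...   | inj₁ empty = subst (_≤ M) (sym empty) z≤n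
    ...   | inj₂ full  = subst (_≤ M) (sym full) ≤-refl

-- The coordinates j of Fin m with r ≤ j (0-based), i.e. those above height r.
tailCoords : (m r : ℕ) → List (Fin m)
tailCoords zero    r       = []
tailCoords (suc m) zero    = fzero ∷ map fsuc (tailCoords m zero)
tailCoords (suc m) (suc r) = map fsuc (tailCoords m r)

tailCoords-length : ∀ m r → length (tailCoords m r) ≡ m ∸ r
tailCoords-length zero    zero    = refl
tailCoords-length zero    (suc r) = refl
tailCoords-length (suc m) zero    = cong suc (trans (length-map fsuc (tailCoords m 0)) (tailCoords-length m 0))
tailCoords-length (suc m) (suc r) = trans (length-map fsuc (tailCoords m r)) (tailCoords-length m r)

tailCoords-complete : ∀ m r (j : Fin m) → r ≤ toℕ j → j ∈ tailCoords m r
tailCoords-complete (suc m) zero    fzero    _         = here refl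
tailCoords-complete (suc m) zero    (fsuc j) _         = there (∈-map⁺ fsuc (tailCoords-complete m 0 j z≤n))
tailCoords-complete (suc m) (suc r) (fsuc j) (s≤s r≤j) = ∈-map⁺ fsuc (tailCoords-complete m r j r≤j)

inHead : ∀ {s m} → Fin m → Fin (suc s) × Fin m
inHead j = fzero , j

inTail : ∀ {s m} → Fin s × Fin m → Fin (suc s) × Fin m
inTail (i , j) = fsuc i , j

-- The positions (i, j) of F_q^{sm} lying above the heights h: these are the
-- coordinates that the linear conditions will force to vanish.
coordsAbove : ∀ m s → (Fin s → ℕ) → List (Fin s × Fin m)
coordsAbove m zero    h = []
coordsAbove m (suc s) h = map inHead (tailCoords m (h fzero)) ++ map inTail (coordsAbove m s (tail h))

coordsAbove-length : ∀ m s h → length (coordsAbove m s h) ≡ ∑ s (λ i → m ∸ h i)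
coordsAbove-length m zero    h = refl
coordsAbove-length m (suc s) h = begin
  length (map inHead heads ++ map inTail rest)         ≡⟨ length-++ (map inHead heads) {map inTail rest} ⟩
  length (map inHead heads) + length (map inTail rest) ≡⟨ cong₂ _+_ (length-map inHead heads) (length-map inTail rest) ⟩
  length heads + length rest                           ≡⟨ cong₂ _+_ (tailCoords-length m (h fzero))
                                                                   (coordsAbove-length m s (tail h)) ⟩
  (m ∸ h fzero) + ∑ s (λ i → m ∸ h (fsuc i))           ∎
  where
    open ≡-Reasoning
    heads = tailCoords m (h fzero)
    rest  = coordsAbove m s (tail h)

coordsAbove-complete : ∀ m s h (i : Fin s) (j : Fin m) → h i ≤ toℕ j → (i , j) ∈ coordsAbove m s h
coordsAbove-complete m (suc s) h fzero    j h≤j =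
  ∈-++⁺ˡ (∈-map⁺ inHead (tailCoords-complete m (h fzero) j h≤j))
coordsAbove-complete m (suc s) h (fsuc i) j h≤j =
  ∈-++⁺ʳ (map inHead (tailCoords m (h fzero))) (∈-map⁺ inTail (coordsAbove-complete m s (tail h) i j h≤j))

module HomogeneousSystems {c ℓ} (R : CommutativeRing c ℓ) (R-field : IsField R)
                          (_≟_ : Decidable (CommutativeRing._≈_ R)) where

  open CommutativeRing R
    renaming ( _+_ to _⊕_; _*_ to _⊗_; -_ to ⊖_; +-comm to ⊕-comm
             ; refl to ≈-refl; sym to ≈-sym; trans to ≈-trans)
    hiding (zero)
  open import Algebra.Properties.Ring ring using (-‿distribˡ-*; -‿distribʳ-*; -‿+-comm)
  open import Algebra.Properties.CommutativeSemigroup (CommutativeRing.+-commutativeSemigroup R)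
    using () renaming (interchange to ⊕-interchange)
  open import Relation.Binary.Reasoning.Setoid setoid

  -- An equation in d unknowns is its coefficient vector g, read as g · x = 0.
  Equation : ℕ → Set c
  Equation d = Fin d → Carrier

  dot : (d : ℕ) → Equation d → (Fin d → Carrier) → Carrier
  dot zero    g x = 0#
  dot (suc d) g x = (g fzero ⊗ x fzero) ⊕ dot d (tail g) (tail x)

  Solves : ∀ {d} → List (Equation d) → (Fin d → Carrier) → Set (c ⊔ ℓ)
  Solves {d} eqs x = ∀ g → g ∈ eqs → dot d g x ≈ 0#

  dot-zeroʳ : ∀ d g → dot d g (λ _ → 0#) ≈ 0#
  dot-zeroʳ zero    g = ≈-refl
  dot-zeroʳ (suc d) g = begin
    (g fzero ⊗ 0#) ⊕ dot d (tail g) (λ _ → 0#) ≈⟨ +-cong (zeroʳ (g fzero)) (dot-zeroʳ d (tail g)) ⟩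
    0# ⊕ 0#                                    ≈⟨ +-identityˡ 0# ⟩
    0#                                         ∎

  ⊗-⊖-assoc : ∀ a b c → a ⊗ ⊖ (b ⊗ c) ≈ ⊖ ((a ⊗ b) ⊗ c)
  ⊗-⊖-assoc a b c = ≈-trans (≈-sym (-‿distribʳ-* a (b ⊗ c))) (-‿cong (≈-sym (*-assoc a b c)))

  -- Linearity of g ↦ g · y, in the form used by one elimination step.
  dot-eliminate : ∀ d (g f y : Fin d → Carrier) a →
                  dot d (λ k → g k ⊕ ⊖ (a ⊗ f k)) y ≈ dot d g y ⊕ ⊖ (a ⊗ dot d f y)
  dot-eliminate zero    g f y a = begin
    0#              ≈⟨ ≈-sym (-‿inverseʳ 0#) ⟩
    0# ⊕ ⊖ 0#       ≈⟨ +-cong ≈-refl (-‿cong (≈-sym (zeroʳ a))) ⟩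
    0# ⊕ ⊖ (a ⊗ 0#) ∎
  dot-eliminate (suc d) g f y a = begin
    ((g₀ ⊕ ⊖ (a ⊗ f₀)) ⊗ y₀) ⊕ dot d (λ k → g′ k ⊕ ⊖ (a ⊗ f′ k)) y′
      ≈⟨ +-cong (distribʳ y₀ g₀ (⊖ (a ⊗ f₀))) (dot-eliminate d g′ f′ y′ a) ⟩
    ((g₀ ⊗ y₀) ⊕ (⊖ (a ⊗ f₀) ⊗ y₀)) ⊕ (dot d g′ y′ ⊕ ⊖ (a ⊗ dot d f′ y′))
      ≈⟨ ⊕-interchange _ _ _ _ ⟩
    ((g₀ ⊗ y₀) ⊕ dot d g′ y′) ⊕ ((⊖ (a ⊗ f₀) ⊗ y₀) ⊕ ⊖ (a ⊗ dot d f′ y′))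
      ≈⟨ +-cong ≈-refl (+-cong (≈-trans (≈-sym (-‿distribˡ-* (a ⊗ f₀) y₀)) (-‿cong (*-assoc a f₀ y₀))) ≈-refl) ⟩
    ((g₀ ⊗ y₀) ⊕ dot d g′ y′) ⊕ (⊖ (a ⊗ (f₀ ⊗ y₀)) ⊕ ⊖ (a ⊗ dot d f′ y′))
      ≈⟨ +-cong ≈-refl (≈-trans (-‿+-comm _ _) (-‿cong (≈-sym (distribˡ a _ _)))) ⟩
    ((g₀ ⊗ y₀) ⊕ dot d g′ y′) ⊕ ⊖ (a ⊗ ((f₀ ⊗ y₀) ⊕ dot d f′ y′)) ∎
    where
      g₀ = g fzero
      f₀ = f fzero
      y₀ = y fzero
      g′ = tail g
      f′ = tail f
      y′ = tail y

  data PivotSplit {d} (eqs : List (Equation (suc d))) : Set (c ⊔ ℓ) where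
    no-pivot : (∀ g → g ∈ eqs → g fzero ≈ 0#) → PivotSplit eqs
    pivot    : (f : Equation (suc d)) (rest : List (Equation (suc d))) →
               ¬ f fzero ≈ 0# → length eqs ≡ suc (length rest) →
               (∀ g → g ∈ eqs → g ≡ f ⊎ g ∈ rest) → PivotSplit eqs

  pivotSplit : ∀ {d} (eqs : List (Equation (suc d))) → PivotSplit eqs
  pivotSplit []       = no-pivot (λ _ ())
  pivotSplit (g ∷ gs) with g fzero ≟ 0#
  ... | no g₀≉0 = pivot g gs g₀≉0 refl (λ { _ (here eq) → inj₁ eq ; _ (there h∈gs) → inj₂ h∈gs })
  ... | yes g₀≈0 with pivotSplit gs
  ...   | no-pivot all≈0 = no-pivot (λ { _ (here refl) → g₀≈0 ; h (there h∈gs) → all≈0 h h∈gs })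
  ...   | pivot f rest f₀≉0 len which =
            pivot f (g ∷ rest) f₀≉0 (cong suc len) (λ { _ (here eq) → inj₂ (here eq)
                                                      ; h (there h∈gs) → keep (which h h∈gs) })
    where
      keep : ∀ {h} → h ≡ f ⊎ h ∈ rest → h ≡ f ⊎ h ∈ g ∷ rest
      keep (inj₁ h≡f)    = inj₁ h≡f
      keep (inj₂ h∈rest) = inj₂ (there h∈rest)

  -- Fewer equations than unknowns: a nonzero solution exists (Gaussian
  -- elimination on the first unknown, by induction on d).
  nontrivialSolution : ∀ d (eqs : List (Equation d)) → length eqs < d →
                       Σ (Fin d → Carrier) λ x → (Σ (Fin d) λ k → ¬ x k ≈ 0#) × Solves eqs x
  nontrivialSolution (suc d) eqs len<d with pivotSplit eqs
  ... | no-pivot all≈0 = unit , (fzero , IsField.1≉0 R-field) , solves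
    where
      unit : Fin (suc d) → Carrier
      unit = 1# ∷ᶠ (λ _ → 0#)
      solves : Solves eqs unit
      solves g g∈eqs = begin
        (g fzero ⊗ 1#) ⊕ dot d (tail g) (λ _ → 0#) ≈⟨ +-cong (*-identityʳ (g fzero)) (dot-zeroʳ d (tail g)) ⟩
        g fzero ⊕ 0#                               ≈⟨ +-identityʳ _ ⟩
        g fzero                                    ≈⟨ all≈0 g g∈eqs ⟩
        0#                                         ∎
  ... | pivot f rest f₀≉0 len which = x , (fsuc k , yk≉0) , solves
    where
      f₀⁻¹ = proj₁ (IsField.inverse R-field (f fzero) f₀≉0)
      f₀f₀⁻¹≈1 : f fzero ⊗ f₀⁻¹ ≈ 1#
      f₀f₀⁻¹≈1 = proj₂ (IsField.inverse R-field (f fzero) f₀≉0)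
      -- subtract the multiple of f that clears the first coefficient of g
      reduce : Equation (suc d) → Equation d
      reduce g k = g (fsuc k) ⊕ ⊖ ((g fzero ⊗ f₀⁻¹) ⊗ f (fsuc k))
      reduced-len : length (map reduce rest) < d
      reduced-len = subst (_< d) (sym (length-map reduce rest)) (≤-pred (subst (_< suc d) len len<d))
      IH = nontrivialSolution d (map reduce rest) reduced-len
      y    = proj₁ IH
      k    = proj₁ (proj₁ (proj₂ IH))
      yk≉0 = proj₂ (proj₁ (proj₂ IH))
      S = dot d (tail f) y
      -- the first unknown is solved for from the pivot equation
      x : Fin (suc d) → Carrier
      x = ⊖ (f₀⁻¹ ⊗ S) ∷ᶠ y
      solves : Solves eqs x
      solves g g∈eqs with which g g∈eqs
      ... | inj₁ refl = begin
        (f fzero ⊗ ⊖ (f₀⁻¹ ⊗ S)) ⊕ S ≈⟨ +-cong (⊗-⊖-assoc (f fzero) f₀⁻¹ S) ≈-refl ⟩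
        ⊖ ((f fzero ⊗ f₀⁻¹) ⊗ S) ⊕ S ≈⟨ +-cong (-‿cong (≈-trans (*-cong f₀f₀⁻¹≈1 ≈-refl) (*-identityˡ S))) ≈-refl ⟩
        ⊖ S ⊕ S                      ≈⟨ -‿inverseˡ S ⟩
        0#                           ∎
      ... | inj₂ g∈rest = begin
        (g fzero ⊗ ⊖ (f₀⁻¹ ⊗ S)) ⊕ Sg ≈⟨ +-cong (⊗-⊖-assoc (g fzero) f₀⁻¹ S) ≈-refl ⟩
        ⊖ ((g fzero ⊗ f₀⁻¹) ⊗ S) ⊕ Sg ≈⟨ ⊕-comm _ _ ⟩
        Sg ⊕ ⊖ ((g fzero ⊗ f₀⁻¹) ⊗ S) ≈⟨ ≈-sym (dot-eliminate d (tail g) (tail f) y _) ⟩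
        dot d (reduce g) y            ≈⟨ proj₂ (proj₂ IH) (reduce g) (∈-map⁺ reduce g∈rest) ⟩
        0#                            ∎
        where Sg = dot d (tail g) y

module _ {c ℓ q} (F : FiniteField c ℓ q) where

  open FiniteField F
    using (Carrier; _≈_; _≟_; 0#; commRing; isField; elements; complete; +-cong)
    renaming (refl to ≈-refl; sym to ≈-sym; trans to ≈-trans; *-comm to ⊗-comm)
  open HomogeneousSystems commRing isField _≟_ using (dot; nontrivialSolution)

  lastNonzero-vanishes : ∀ m (a : Vector F m) j → lastNonzero F m a ≤ toℕ j → a j ≈ 0#
  lastNonzero-vanishes (suc m) a j bound with lastNonzero F m (λ i → a (fsuc i)) in tail-eq
  lastNonzero-vanishes (suc m) a (fsuc j) (s≤s bound) | suc l =
    lastNonzero-vanishes m (λ i → a (fsuc i)) j (subst (_≤ toℕ j) (sym tail-eq) bound)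
  ... | zero with a fzero ≟ 0#
  lastNonzero-vanishes (suc m) a fzero    bound | zero | yes a₀≈0 = a₀≈0
  lastNonzero-vanishes (suc m) a (fsuc j) bound | zero | yes _    =
    lastNonzero-vanishes m (λ i → a (fsuc i)) j (subst (_≤ toℕ j) (sym tail-eq) z≤n)
  lastNonzero-vanishes (suc m) a (fsuc j) bound | zero | no _     =
    lastNonzero-vanishes m (λ i → a (fsuc i)) j (subst (_≤ toℕ j) (sym tail-eq) z≤n)

  lastNonzero-least : ∀ m (a : Vector F m) r → (∀ j → r ≤ toℕ j → a j ≈ 0#) → lastNonzero F m a ≤ r
  lastNonzero-least zero    a r vanish = z≤n
  lastNonzero-least (suc m) a zero vanish
    with lastNonzero F m (λ i → a (fsuc i))
       | lastNonzero-least m (λ i → a (fsuc i)) zero (λ j _ → vanish (fsuc j) z≤n)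
  ... | suc _ | ()
  ... | zero  | _ with a fzero ≟ 0#
  ...   | yes _   = z≤n
  ...   | no a₀≉0 = ⊥-elim (a₀≉0 (vanish fzero z≤n))
  lastNonzero-least (suc m) a (suc r) vanish
    with lastNonzero F m (λ i → a (fsuc i))
       | lastNonzero-least m (λ i → a (fsuc i)) r (λ j r≤j → vanish (fsuc j) (s≤s r≤j))
  ... | suc _ | tail≤r = s≤s tail≤r
  ... | zero  | _ with a fzero ≟ 0#
  ...   | yes _ = z≤n
  ...   | no _  = s≤s z≤n

  lastNonzero-cong : ∀ m (a b : Vector F m) → (∀ j → a j ≈ b j) → lastNonzero F m a ≡ lastNonzero F m b
  lastNonzero-cong m a b a≈b = ≤-antisym
    (lastNonzero-least m a _ (λ j lb≤j → ≈-trans (a≈b j) (lastNonzero-vanishes m b j lb≤j)))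
    (lastNonzero-least m b _ (λ j la≤j → ≈-trans (≈-sym (a≈b j)) (lastNonzero-vanishes m a j la≤j)))

  v-cong : ∀ m e (a b : Vector F m) → (∀ j → a j ≈ b j) → v F m e a ≡ v F m e b
  v-cong m e a b a≈b with lastNonzero F m a | lastNonzero F m b | lastNonzero-cong m a b a≈b
  ... | zero  | .zero  | refl = refl
  ... | suc l | .suc l | refl = refl

  V-cong : ∀ s m e (A B : Block F s m) → _≈ᴮ_ F A B → V F s m e A ≡ V F s m e B
  V-cong s m e A B A≈B = ∑-cong s (λ i → v-cong m (e i) (A i) (B i) (A≈B i))

  v-≤-length : ∀ m e (a : Vector F m) → v F m e a ≤ m
  v-≤-length m e a with lastNonzero F m a
  ... | zero  = z≤n
  ... | suc _ = m⊓n≤m m _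

  v-≤-support : ∀ m e (a : Vector F m) r → 1 ≤ e → lastNonzero F m a ≤ r → v F m e a ≤ r + (e ∸ 1)
  v-≤-support m e a r 1≤e lnz≤r with lastNonzero F m a
  ... | zero = z≤n
  v-≤-support m (suc e′) a r _ lnz≤r | suc l = begin
    m ⊓ (suc e′ * ((suc l + e′) / suc e′)) ≤⟨ m⊓n≤n m _ ⟩
    suc e′ * ((suc l + e′) / suc e′)       ≡⟨ *-comm (suc e′) _ ⟩
    ((suc l + e′) / suc e′) * suc e′       ≤⟨ m/n*n≤m (suc l + e′) (suc e′) ⟩
    suc l + e′                             ≤⟨ +-monoˡ-≤ e′ lnz≤r ⟩
    r + e′                                 ∎
    where open ≤-Reasoning

  v-≤-emptyOrFull : ∀ m e (a : Vector F m) r → EmptyOrFull m r → lastNonzero F m a ≤ r → v F m e a ≤ r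
  v-≤-emptyOrFull m e a r (inj₂ refl) _ = v-≤-length m e a
  v-≤-emptyOrFull m e a r (inj₁ refl) lnz≤0 with lastNonzero F m a | lnz≤0
  ... | zero | _ = z≤n

  V-≤-profile : ∀ s m (e : Fin s → ℕ) {i₀ k} (P : Profile m s i₀ k) (A : Block F s m) → 1 ≤ e i₀ →
                (∀ i j → Profile.height P i ≤ toℕ j → A i j ≈ 0#) → V F s m e A ≤ k + (e i₀ ∸ 1)
  V-≤-profile s m e {i₀} P A 1≤e vanish =
    subst (λ n → V F s m e A ≤ n + (e i₀ ∸ 1)) height-sum
      (∑-≤-except s _ height i₀ (e i₀ ∸ 1)
        (λ i i≢i₀ → v-≤-emptyOrFull m (e i) (A i) (height i) (height-shape i i≢i₀) (supported i))
        (v-≤-support m (e i₀) (A i₀) (height i₀) 1≤e (supported i₀)))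
    where
      open Profile P
      supported : ∀ i → lastNonzero F m (A i) ≤ height i
      supported i = lastNonzero-least m (A i) (height i) (vanish i)

  isZeroᴮ-sound : ∀ s m (A : Block F s m) → isZeroᴮ F A ≡ true → _≈ᴮ_ F A (0ᴮ F)
  isZeroᴮ-sound (suc s) m A isZero i j with lastNonzero F m (A fzero) in head-eq
  isZeroᴮ-sound (suc s) m A isZero fzero    j | zero =
    lastNonzero-vanishes m (A fzero) j (subst (_≤ toℕ j) (sym head-eq) z≤n)
  isZeroᴮ-sound (suc s) m A isZero (fsuc i) j | zero =
    isZeroᴮ-sound s m (tail A) isZero i j

  allFuns-complete : ∀ {x a r} {X : Set x} {A : Set a} (R : X → A → Set r) (xs : List A) n (f : Fin n → X) →
                     (∀ i → Any (R (f i)) xs) → Any (λ g → ∀ i → R (f i) (g i)) (allFuns F xs n)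
  allFuns-complete R xs zero    f covered = here (λ ())
  allFuns-complete R xs (suc n) f covered =
    concatMap⁺ _ (Any.map (λ r₀ → map⁺ (Any.map (λ rest → λ { fzero → r₀ ; (fsuc i) → rest i })
                                                (allFuns-complete R xs n (tail f) (λ i → covered (fsuc i)))))
                          (covered fzero))

  module _ {s m} (e : Fin s → ℕ) (N : Subspace F s m) where
    open Subspace N

    δ-step : Block F s m → ℕ → ℕ
    δ-step A acc = if does (Mem? A) then (if isZeroᴮ F A then acc else (V F s m e A ⊓ acc)) else acc

    blocks : List (Block F s m)
    blocks = allFuns F (allFuns F elements m) s

    δ-step-decreasing : ∀ A acc → δ-step A acc ≤ acc
    δ-step-decreasing A acc with does (Mem? A) | isZeroᴮ F A
    ... | false | _     = ≤-refl
    ... | true  | true  = ≤-refl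
    ... | true  | false = m⊓n≤n _ _

    δ-≤-empty : δ F s m e N ≤ s * m + 1
    δ-≤-empty = foldr-≤-init δ-step δ-step-decreasing (s * m + 1) blocks

    δ-≤-V : ∀ A → Mem A → ¬ _≈ᴮ_ F A (0ᴮ F) → δ F s m e N ≤ V F s m e A
    δ-≤-V A A∈N A≉0 = foldr-≤-witness δ-step δ-step-decreasing (s * m + 1) _ blocks
      (Any.map (λ {B} A≈B → hit B A≈B)
        (allFuns-complete (λ a b → ∀ j → a j ≈ b j) (allFuns F elements m) s A
          (λ i → allFuns-complete _≈_ elements m (A i) (λ j → complete (A i j)))))
      where
        hit : ∀ B → _≈ᴮ_ F A B → ∀ acc → δ-step B acc ≤ V F s m e A
        hit B A≈B acc with Mem? B | isZeroᴮ F B in zero-test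
        ... | no B∉N | _     = ⊥-elim (B∉N (respect A≈B A∈N))
        ... | yes _  | true  = ⊥-elim (A≉0 (λ i j → ≈-trans (A≈B i j) (isZeroᴮ-sound s m B zero-test i j)))
        ... | yes _  | false = ≤-trans (m⊓n≤m _ _) (≤-reflexive (sym (V-cong s m e A B A≈B)))

  lincomb-coord : ∀ {s m} d cf (b : Fin d → Block F s m) i j →
                  lincomb F d cf b i j ≈ dot d (λ k → b k i j) cf
  lincomb-coord zero    cf b i j = ≈-refl
  lincomb-coord (suc d) cf b i j = +-cong (⊗-comm _ _) (lincomb-coord d (tail cf) (tail b) i j)

  lincomb∈ : ∀ {s m} (N : Subspace F s m) d cf (b : Fin d → Block F s m) →
             (∀ k → Subspace.Mem N (b k)) → Subspace.Mem N (lincomb F d cf b)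
  lincomb∈ N zero    cf b b∈N = Subspace.zero∈ N
  lincomb∈ N (suc d) cf b b∈N =
    Subspace.+∈ N (Subspace.·∈ N _ (b∈N fzero)) (lincomb∈ N d (tail cf) (tail b) (λ k → b∈N (fsuc k)))

  -- A subspace of dimension d contains a nonzero element vanishing at any
  -- prescribed fewer than d coordinates: solve for its coordinates in the basis.
  vanishingElement : ∀ {s m} (N : Subspace F s m) d → HasDim F N d →
                     (L : List (Fin s × Fin m)) → length L < d →
                     Σ (Block F s m) λ A → Subspace.Mem N A × ¬ _≈ᴮ_ F A (0ᴮ F)
                                         × (∀ i j → (i , j) ∈ L → A i j ≈ 0#)
  vanishingElement N d basis L L<d = A , lincomb∈ N d x vec vec∈ , A≉0 , A-vanishes
    where
      open Basis basis
      coordinate : Fin _ × Fin _ → Fin d → Carrier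
      coordinate (i , j) k = vec k i j
      solution = nontrivialSolution d (map coordinate L) (subst (_< d) (sym (length-map coordinate L)) L<d)
      x = proj₁ solution
      A = lincomb F d x vec
      A≉0 : ¬ _≈ᴮ_ F A (0ᴮ F)
      A≉0 A≈0 with proj₁ (proj₂ solution)
      ... | k , xk≉0 = xk≉0 (independent x A≈0 k)
      A-vanishes : ∀ i j → (i , j) ∈ L → A i j ≈ 0#
      A-vanishes i j ij∈L =
        ≈-trans (lincomb-coord d x vec i j) (proj₂ (proj₂ solution) (coordinate (i , j)) (∈-map⁺ coordinate ij∈L))

  δ-≤-profile : ∀ {s m} (N : Subspace F s m) d → HasDim F N d → (e : Fin s → ℕ) {i₀ : Fin s} →
                1 ≤ e i₀ → ∀ {k} (P : Profile m s i₀ k) → s * m < d + k →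
                δ F s m e N ≤ k + (e i₀ ∸ 1)
  δ-≤-profile {s} {m} N d basis e 1≤e {k} P sm<d+k
    with vanishingElement N d basis (coordsAbove m s height) few
    where
      open Profile P
      few : length (coordsAbove m s height) < d
      few = +-cancelʳ-< k _ d (begin-strict
        length (coordsAbove m s height) + k   ≡⟨ cong₂ _+_ (coordsAbove-length m s height) (sym height-sum) ⟩
        ∑ s (λ i → m ∸ height i) + ∑ s height ≡⟨ ∑-complement s m height height≤ ⟩
        s * m                                 <⟨ sm<d+k ⟩
        d + k                                 ∎)
        where open ≤-Reasoning
  ... | A , A∈N , A≉0 , A-vanishes = ≤-trans (δ-≤-V e N A A∈N A≉0)
          (V-≤-profile s m e P A 1≤e (λ i j h≤j → A-vanishes i j (coordsAbove-complete m s _ i j h≤j)))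

proposition7 : ∀ {c ℓ : Level} {q : ℕ} (F : FiniteField c ℓ q)
               (s m : ℕ) → 1 ≤ s → 1 ≤ m →
               (N : Subspace F s m) (d : ℕ) → HasDim F N d →
               (e : Fin s → ℕ) → (∀ i → 1 ≤ e i) →
               δ F s m e N ≤ s * m ∸ d + minᶠ s e
proposition7 F (suc s′) (suc m′) _ _ N d basis e 1≤e with minᶠ-attained (suc s′) e (s≤s z≤n)
-- N = {0}: δ = sm + 1 and min e ≥ 1
proposition7 F (suc s′) (suc m′) _ _ N zero     _     e 1≤e | i₀ , e-min =
  ≤-trans (δ-≤-empty F e N) (+-monoʳ-≤ (suc s′ * suc m′) (subst (1 ≤_) e-min (1≤e i₀)))
-- d ≥ 1: a profile of total X + 1 with X = sm − d < sm
proposition7 F (suc s′) (suc m′) _ _ N (suc d′) basis e 1≤e | i₀ , e-min = begin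
  δ F s M e N        ≤⟨ δ-≤-profile F N (suc d′) basis e (1≤e i₀) P (n<d+suc[n∸d] (s * M) (suc d′)) ⟩
  suc X + (e i₀ ∸ 1) ≡⟨ suc-+-pred X (e i₀) (1≤e i₀) ⟩
  X + e i₀           ≡⟨ cong (X +_) e-min ⟩
  X + minᶠ s e       ∎
  where
    open ≤-Reasoning
    s = suc s′
    M = suc m′
    X = s * M ∸ suc d′
    P : Profile M s i₀ (suc X)
    P = profile M s i₀ X (∸-suc-< (m′ + s′ * M) d′)
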